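{- Let the Gandhi polynomials $\tilde P_r(z)$ ($r\ge1$) be defined by $\tilde P_1(z)=1$ and $\tilde P_{r+1}(z)=(z+1)^2\tilde P_r(z+1)-z^2\tilde P_r(z)$. Then for every integer $r\ge1$ and every positive integer $n$, \[ \tilde P_r(-n)=(-1)^{r-1}\,\frac{2}{n^2}\binom{2n}{n}^{ -1}\sum_{k=1}^{n}\binom{2n}{n-k}k^{2r+1}. \] In particular $\tilde P_r(-1)=(-1)^{r-1}$ and $\tilde P_r(-2)=(-1)^{r-1}\,\frac{2^{2r-1}+1}{3}$. -}

module Defs where

open import Data.Nat as ℕ using (ℕ; zero; suc)
open import Data.Integer using (ℤ; +_; _+_; _-_; _*_; -_; _^_)

-- Index 0 is an unused junk value (0).
P̃ : ℕ → ℤ → ℤ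
P̃ zero z = + 0
P̃ (suc zero) z = + 1
P̃ (suc (suc r)) z =
  ((z + + 1) ^ 2) * P̃ (suc r) (z + + 1) - (z ^ 2) * P̃ (suc r) z

Σ₁ : ℕ → (ℕ → ℤ) → ℤ
Σ₁ zero f = + 0
Σ₁ (suc n) f = Σ₁ n f + f (suc n)

-- Let μ_e(n) = Σ_{k=1}^{n} C(2n,n-k) k^e. Since ((n+1)² - k²) C(2n+2,n+1-k) = (2n+2)(2n+1) C(2n,n-k),
-- the moments satisfy μ_{e+2}(n+1) = (n+1)² μ_e(n+1) - (2n+2)(2n+1) μ_e(n). As
-- (n+1) C(2n+2,n+1) = 2(2n+1) C(2n,n), this matches the Gandhi recurrence
-- P̃_{r+1}(-(n+1)) = n² P̃_r(-n) - (n+1)² P̃_r(-(n+1)) multiplied by (n+1)² C(2n+2,n+1),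
-- so the identity propagates from r to r+1.
-- The case r = 1, 2μ_3(n) = n² C(2n,n), follows from the same moment recurrence together with the
-- telescoping sum 2μ_1(n) = n C(2n,n).

module Submission where

open import Data.List.Base using ([]; _∷_)
open import Data.Product.Base using (_,_)
open import Relation.Binary.PropositionalEquality using (_≡_; refl; sym; trans; cong; cong₂; subst; module ≡-Reasoning)
open ≡-Reasoning

module Binomial where

  open import Data.Nat.Base
  open import Data.Nat.Properties
  open import Data.Nat.Combinatorics using (_C_; nCk+nC[k+1]≡[n+1]C[k+1]; nC1≡n)
  open import Data.Nat.Tactic.RingSolver using (solve)

  [k+1]*[n+1]C[k+1]≡[n+1]*nCk : ∀ n k → suc k * (suc n C suc k) ≡ suc n * (n C k)
  [k+1]*[n+1]C[k+1]≡[n+1]*nCk zero    zero    = refl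
  [k+1]*[n+1]C[k+1]≡[n+1]*nCk zero    (suc k) = *-zeroʳ (2 + k)
  [k+1]*[n+1]C[k+1]≡[n+1]*nCk (suc n) zero    = begin
    1 * ((2 + n) C 1) ≡⟨ *-identityˡ _ ⟩
    (2 + n) C 1       ≡⟨ nC1≡n (2 + n) ⟩
    2 + n             ≡⟨ *-identityʳ (2 + n) ⟨
    (2 + n) * 1       ∎
  [k+1]*[n+1]C[k+1]≡[n+1]*nCk (suc n) (suc k) = begin
    (2 + k) * ((2 + n) C (2 + k))
      ≡⟨ cong ((2 + k) *_) (nCk+nC[k+1]≡[n+1]C[k+1] (suc n) (suc k)) ⟨
    (2 + k) * (a + b)
      ≡⟨ *-distribˡ-+ (2 + k) a b ⟩
    a + (1 + k) * a + (2 + k) * b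
      ≡⟨ +-assoc a _ _ ⟩
    a + ((1 + k) * a + (2 + k) * b)
      ≡⟨ cong (a +_) (cong₂ _+_ ([k+1]*[n+1]C[k+1]≡[n+1]*nCk n k) ([k+1]*[n+1]C[k+1]≡[n+1]*nCk n (suc k))) ⟩
    a + ((1 + n) * (n C k) + (1 + n) * (n C suc k))
      ≡⟨ cong (a +_) (*-distribˡ-+ (1 + n) (n C k) (n C suc k)) ⟨
    a + (1 + n) * (n C k + n C suc k)
      ≡⟨ cong (λ x → a + (1 + n) * x) (nCk+nC[k+1]≡[n+1]C[k+1] n k) ⟩
    a + (1 + n) * a
      ∎
    where
    a = suc n C suc k
    b = suc n C (2 + k)

  [n+1]*nCk+k*[n+1]Ck≡[n+1]*[n+1]Ck : ∀ n k → suc n * (n C k) + k * (suc n C k) ≡ suc n * (suc n C k)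
  [n+1]*nCk+k*[n+1]Ck≡[n+1]*[n+1]Ck n zero    = +-identityʳ _
  [n+1]*nCk+k*[n+1]Ck≡[n+1]*[n+1]Ck n (suc k) = begin
    suc n * (n C suc k) + suc k * (suc n C suc k)
      ≡⟨ cong (suc n * (n C suc k) +_) ([k+1]*[n+1]C[k+1]≡[n+1]*nCk n k) ⟩
    suc n * (n C suc k) + suc n * (n C k)
      ≡⟨ *-distribˡ-+ (suc n) (n C suc k) (n C k) ⟨
    suc n * (n C suc k + n C k)
      ≡⟨ cong (suc n *_) (+-comm (n C suc k) (n C k)) ⟩
    suc n * (n C k + n C suc k)
      ≡⟨ cong (suc n *_) (nCk+nC[k+1]≡[n+1]C[k+1] n k) ⟩
    suc n * (suc n C suc k)
      ∎

  [k+1]*[n+1]C[k+1]+k*[n+1]Ck≡[n+1]*[n+1]Ck : ∀ n k → suc k * (suc n C suc k) + k * (suc n C k) ≡ suc n * (suc n C k)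
  [k+1]*[n+1]C[k+1]+k*[n+1]Ck≡[n+1]*[n+1]Ck n k =
    trans (cong (_+ k * (suc n C k)) ([k+1]*[n+1]C[k+1]≡[n+1]*nCk n k)) ([n+1]*nCk+k*[n+1]Ck≡[n+1]*[n+1]Ck n k)

  [n+1]*[2n+2]C[n+1]≡2*[n+1]*[2n+1]Cn : ∀ n → suc n * ((2 * suc n) C suc n) ≡ 2 * (suc n * (suc (2 * n) C n))
  [n+1]*[2n+2]C[n+1]≡2*[n+1]*[2n+1]Cn n = begin
    suc n * ((2 * suc n) C suc n)   ≡⟨ cong (λ N → suc n * (N C suc n)) (*-suc 2 n) ⟩
    suc n * ((2 + 2 * n) C suc n)   ≡⟨ [k+1]*[n+1]C[k+1]≡[n+1]*nCk (suc (2 * n)) n ⟩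
    (2 + 2 * n) * (suc (2 * n) C n) ≡⟨ cong (_* (suc (2 * n) C n)) (*-suc 2 n) ⟨
    2 * suc n * (suc (2 * n) C n)   ≡⟨ *-assoc 2 (suc n) _ ⟩
    2 * (suc n * (suc (2 * n) C n)) ∎

  [n+1]*[2n+1]Cn≡[2n+1]*[2n]Cn : ∀ n → suc n * (suc (2 * n) C n) ≡ suc (2 * n) * ((2 * n) C n)
  [n+1]*[2n+1]Cn≡[2n+1]*[2n]Cn n = +-cancelʳ-≡ (n * c) _ _ (begin
    suc n * c + n * c          ≡⟨ *-distribʳ-+ c (suc n) n ⟨
    (suc n + n) * c            ≡⟨ cong (λ x → suc (n + x) * c) (+-identityʳ n) ⟨
    suc (2 * n) * c            ≡⟨ [n+1]*nCk+k*[n+1]Ck≡[n+1]*[n+1]Ck (2 * n) n ⟨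
    suc (2 * n) * ((2 * n) C n) + n * c ∎)
    where c = suc (2 * n) C n

  [n+1]*[2n+2]C[n+1]≡2*[2n+1]*[2n]Cn : ∀ n → suc n * ((2 * suc n) C suc n) ≡ 2 * suc (2 * n) * ((2 * n) C n)
  [n+1]*[2n+2]C[n+1]≡2*[2n+1]*[2n]Cn n = begin
    suc n * ((2 * suc n) C suc n)      ≡⟨ [n+1]*[2n+2]C[n+1]≡2*[n+1]*[2n+1]Cn n ⟩
    2 * (suc n * (suc (2 * n) C n))    ≡⟨ cong (2 *_) ([n+1]*[2n+1]Cn≡[2n+1]*[2n]Cn n) ⟩
    2 * (suc (2 * n) * ((2 * n) C n))  ≡⟨ *-assoc 2 (suc (2 * n)) _ ⟨
    2 * suc (2 * n) * ((2 * n) C n)    ∎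

  C-moment-step : ∀ k j → let m = k + j in
    k * k * ((2 * suc m) C suc j) + 2 * suc m * suc (2 * m) * ((2 * m) C j) ≡ suc m * suc m * ((2 * suc m) C suc j)
  C-moment-step k j = arith
    (subst (λ n → suc j * (n C suc j) ≡ n * (suc (2 * (k + j)) C j)) (sym (*-suc 2 (k + j)))
      ([k+1]*[n+1]C[k+1]≡[n+1]*nCk (suc (2 * (k + j))) j))
    ([n+1]*nCk+k*[n+1]Ck≡[n+1]*[n+1]Ck (2 * (k + j)) j)
    where
    arith : ∀ {x y z} → suc j * z ≡ 2 * suc (k + j) * y → suc (2 * (k + j)) * x + j * y ≡ suc (2 * (k + j)) * y →
            k * k * z + 2 * suc (k + j) * suc (2 * (k + j)) * x ≡ suc (k + j) * suc (k + j) * z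
    arith {x} {y} {z} absorb complement = +-cancelʳ-≡ (j * (suc j * z)) _ _ (begin
      k * k * z + 2 * suc (k + j) * suc (2 * (k + j)) * x + j * (suc j * z)
        ≡⟨ cong (λ w → k * k * z + 2 * suc (k + j) * suc (2 * (k + j)) * x + j * w) absorb ⟩
      k * k * z + 2 * suc (k + j) * suc (2 * (k + j)) * x + j * (2 * suc (k + j) * y)
        ≡⟨ solve (k ∷ j ∷ x ∷ y ∷ z ∷ []) ⟩
      k * k * z + 2 * suc (k + j) * (suc (2 * (k + j)) * x + j * y)
        ≡⟨ cong (λ w → k * k * z + 2 * suc (k + j) * w) complement ⟩
      k * k * z + 2 * suc (k + j) * (suc (2 * (k + j)) * y)
        ≡⟨ solve (k ∷ j ∷ y ∷ z ∷ []) ⟩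
      k * k * z + suc (2 * (k + j)) * (2 * suc (k + j) * y)
        ≡⟨ cong (λ w → k * k * z + suc (2 * (k + j)) * w) absorb ⟨
      k * k * z + suc (2 * (k + j)) * (suc j * z)
        ≡⟨ solve (k ∷ j ∷ z ∷ []) ⟩
      suc (k + j) * suc (k + j) * z + j * (suc j * z)
        ∎)

  -- n ∸ k truncates at 0, so this is the summand C(2n, n - k) k^e only for k ≤ n.
  momentTerm : ℕ → ℕ → ℕ → ℕ
  momentTerm e n k = ((2 * n) C (n ∸ k)) * k ^ e

  momentTerm-step : ∀ e {k m} → k ≤ m →
    momentTerm (2 + e) (suc m) k + 2 * suc m * suc (2 * m) * momentTerm e m k ≡ suc m * suc m * momentTerm e (suc m) k
  momentTerm-step e {k} k≤m with m≤n⇒∃[o]m+o≡n k≤m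
  ... | j , refl rewrite +-∸-assoc 1 (m≤m+n k j) | m+n∸m≡n k j =
    scale (C-moment-step k j)
    where
    scale : ∀ {z c x} → k * k * z + 2 * suc (k + j) * suc (2 * (k + j)) * c ≡ suc (k + j) * suc (k + j) * z →
            z * (k * (k * x)) + 2 * suc (k + j) * suc (2 * (k + j)) * (c * x) ≡ suc (k + j) * suc (k + j) * (z * x)
    scale {z} {c} {x} eq = begin
      z * (k * (k * x)) + 2 * suc (k + j) * suc (2 * (k + j)) * (c * x)
        ≡⟨ solve (k ∷ j ∷ z ∷ c ∷ x ∷ []) ⟩
      (k * k * z + 2 * suc (k + j) * suc (2 * (k + j)) * c) * x
        ≡⟨ cong (_* x) eq ⟩
      suc (k + j) * suc (k + j) * z * x
        ≡⟨ *-assoc (suc (k + j) * suc (k + j)) z x ⟩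
      suc (k + j) * suc (k + j) * (z * x)
        ∎

  momentTerm-diagonal : ∀ e n → momentTerm e n n ≡ n ^ e
  momentTerm-diagonal e n = begin
    ((2 * n) C (n ∸ n)) * n ^ e ≡⟨ cong (λ i → ((2 * n) C i) * n ^ e) (n∸n≡0 n) ⟩
    1 * n ^ e                   ≡⟨ *-identityˡ (n ^ e) ⟩
    n ^ e                       ∎

  momentTerm-last : ∀ e n → momentTerm (2 + e) n n ≡ n * n * momentTerm e n n
  momentTerm-last e n = begin
    momentTerm (2 + e) n n ≡⟨ momentTerm-diagonal (2 + e) n ⟩
    n * (n * n ^ e)        ≡⟨ *-assoc n n (n ^ e) ⟨
    n * n * n ^ e          ≡⟨ cong (n * n *_) (momentTerm-diagonal e n) ⟨
    n * n * momentTerm e n n ∎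

  momentTerm-first-telescope : ∀ {k m} → k < m →
    momentTerm 1 (suc m) (suc k) + suc m * (suc (2 * m) C (m ∸ suc k)) ≡ suc m * (suc (2 * m) C (m ∸ k))
  momentTerm-first-telescope {k} k<m with m≤n⇒∃[o]m+o≡n k<m
  ... | j , refl rewrite +-∸-assoc 1 (m≤m+n k j) | m+n∸m≡n k j =
    arith (subst (λ n → suc (2 * m) C j + suc (2 * m) C suc j ≡ n C suc j) (sym (*-suc 2 m))
                  (nCk+nC[k+1]≡[n+1]C[k+1] (suc (2 * m)) j))
          ([k+1]*[n+1]C[k+1]+k*[n+1]Ck≡[n+1]*[n+1]Ck (2 * m) j)
    where
    m = suc (k + j)
    arith : ∀ {x y z} → x + y ≡ z → suc j * y + j * x ≡ suc (2 * suc (k + j)) * x →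
            z * (suc k * 1) + suc (suc (k + j)) * x ≡ suc (suc (k + j)) * y
    arith {x} {y} {z} pascal ratio = +-cancelʳ-≡ (j * x) _ _ (begin
      z * (suc k * 1) + suc (suc (k + j)) * x + j * x
        ≡⟨ cong (λ w → w * (suc k * 1) + suc (suc (k + j)) * x + j * x) pascal ⟨
      (x + y) * (suc k * 1) + suc (suc (k + j)) * x + j * x
        ≡⟨ solve (k ∷ j ∷ x ∷ y ∷ []) ⟩
      suc k * y + suc (2 * suc (k + j)) * x
        ≡⟨ cong (suc k * y +_) ratio ⟨
      suc k * y + (suc j * y + j * x)
        ≡⟨ solve (k ∷ j ∷ x ∷ y ∷ []) ⟩
      suc (suc (k + j)) * y + j * x
        ∎)

open Binomial using (momentTerm; momentTerm-step; momentTerm-last; momentTerm-diagonal; momentTerm-first-telescope;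
                     [n+1]*[2n+2]C[n+1]≡2*[n+1]*[2n+1]Cn; [n+1]*[2n+2]C[n+1]≡2*[2n+1]*[2n]Cn)

open import Defs
open import Data.Nat as ℕ using (ℕ; suc; _≤_)
open import Data.Nat.Combinatorics using (_C_)
open import Data.Integer using (ℤ; +_; _*_; -_; _^_; _+_)
open import Data.Product using (_×_)
open import Relation.Binary.PropositionalEquality using (_≡_)

open import Data.Nat.Properties as ℕ using (m≤n⇒m≤1+n; n∸n≡0; ^-zeroˡ)
open import Data.Integer using (_-_)
open import Data.Integer.Properties
  using (pos-+; pos-*; +-identityˡ; +-assoc; +-commutativeSemigroup; *-zeroʳ; *-identityʳ; *-assoc; *-comm; *-distribˡ-+; *-cancelˡ-≡)
open import Algebra.Properties.CommutativeSemigroup +-commutativeSemigroup using (interchange; xy∙z≈xz∙y)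
open import Data.Integer.Tactic.RingSolver using (solve)
open import Data.Nat.Tactic.RingSolver using () renaming (solve to ℕ-solve)

Σ₁-cong : ∀ n {f g : ℕ → ℤ} → (∀ {k} → 1 ≤ k → k ≤ n → f k ≡ g k) → Σ₁ n f ≡ Σ₁ n g
Σ₁-cong ℕ.zero    eq = refl
Σ₁-cong (suc n) eq = cong₂ _+_ (Σ₁-cong n (λ 1≤k k≤n → eq 1≤k (m≤n⇒m≤1+n k≤n))) (eq (ℕ.s≤s ℕ.z≤n) ℕ.≤-refl)

Σ₁-+ : ∀ n (f g : ℕ → ℤ) → Σ₁ n (λ k → f k + g k) ≡ Σ₁ n f + Σ₁ n g
Σ₁-+ ℕ.zero    f g = refl
Σ₁-+ (suc n) f g =
  trans (cong (_+ (f (suc n) + g (suc n))) (Σ₁-+ n f g)) (interchange (Σ₁ n f) (Σ₁ n g) (f (suc n)) (g (suc n)))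

Σ₁-*ˡ : ∀ n c (f : ℕ → ℤ) → Σ₁ n (λ k → c * f k) ≡ c * Σ₁ n f
Σ₁-*ˡ ℕ.zero    c f = sym (*-zeroʳ c)
Σ₁-*ˡ (suc n) c f = trans (cong (_+ c * f (suc n)) (Σ₁-*ˡ n c f)) (sym (*-distribˡ-+ c (Σ₁ n f) (f (suc n))))

Σ₁-telescope : ∀ n (f g : ℕ → ℤ) → (∀ {k} → k ℕ.< n → f (suc k) + g (suc k) ≡ g k) → Σ₁ n f + g n ≡ g 0
Σ₁-telescope ℕ.zero    f g step = +-identityˡ (g 0)
Σ₁-telescope (suc n) f g step = begin
  Σ₁ n f + f (suc n) + g (suc n)   ≡⟨ +-assoc (Σ₁ n f) (f (suc n)) (g (suc n)) ⟩
  Σ₁ n f + (f (suc n) + g (suc n)) ≡⟨ cong (_+_ (Σ₁ n f)) (step ℕ.≤-refl) ⟩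
  Σ₁ n f + g n                     ≡⟨ Σ₁-telescope n f g (λ k<n → step (m≤n⇒m≤1+n k<n)) ⟩
  g 0                              ∎

pos-*₃ : ∀ a b c → + (a ℕ.* b ℕ.* c) ≡ + a * + b * + c
pos-*₃ a b c = trans (pos-* (a ℕ.* b) c) (cong (_* + c) (pos-* a b))

moment : ℕ → ℕ → ℤ
moment e n = Σ₁ n (λ k → + momentTerm e n k)

moment-step : ∀ e m →
  moment (2 ℕ.+ e) (suc m) + + 2 * + suc m * + suc (2 ℕ.* m) * moment e m ≡ + suc m * + suc m * moment e (suc m)
moment-step e m = begin
  Σ₁ m f + f (suc m) + d * Σ₁ m g
    ≡⟨ xy∙z≈xz∙y (Σ₁ m f) (f (suc m)) (d * Σ₁ m g) ⟩
  Σ₁ m f + d * Σ₁ m g + f (suc m)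
    ≡⟨ cong (λ w → Σ₁ m f + w + f (suc m)) (Σ₁-*ˡ m d g) ⟨
  Σ₁ m f + Σ₁ m (λ k → d * g k) + f (suc m)
    ≡⟨ cong (_+ f (suc m)) (Σ₁-+ m f (λ k → d * g k)) ⟨
  Σ₁ m (λ k → f k + d * g k) + f (suc m)
    ≡⟨ cong₂ _+_ (Σ₁-cong m (λ _ k≤m → termwise k≤m)) last ⟩
  Σ₁ m (λ k → q * h k) + q * h (suc m)
    ≡⟨ cong (_+ q * h (suc m)) (Σ₁-*ˡ m q h) ⟩
  q * Σ₁ m h + q * h (suc m)
    ≡⟨ *-distribˡ-+ q (Σ₁ m h) (h (suc m)) ⟨
  q * moment e (suc m)
    ∎
  where
  f g h : ℕ → ℤ
  f k = + momentTerm (2 ℕ.+ e) (suc m) k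
  g k = + momentTerm e m k
  h k = + momentTerm e (suc m) k
  d q : ℤ
  d = + 2 * + suc m * + suc (2 ℕ.* m)
  q = + suc m * + suc m
  termwise : ∀ {k} → k ≤ m → f k + d * g k ≡ q * h k
  termwise {k} k≤m = begin
    f k + d * g k
      ≡⟨ cong (λ w → f k + w * g k) (pos-*₃ 2 (suc m) (suc (2 ℕ.* m))) ⟨
    f k + + D * g k
      ≡⟨ cong (_+_ (f k)) (pos-* D (momentTerm e m k)) ⟨
    + (momentTerm (2 ℕ.+ e) (suc m) k ℕ.+ D ℕ.* momentTerm e m k)
      ≡⟨ cong +_ (momentTerm-step e k≤m) ⟩
    + (suc m ℕ.* suc m ℕ.* momentTerm e (suc m) k)
      ≡⟨ pos-*₃ (suc m) (suc m) (momentTerm e (suc m) k) ⟩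
    q * h k
      ∎
    where D = 2 ℕ.* suc m ℕ.* suc (2 ℕ.* m)
  last : f (suc m) ≡ q * h (suc m)
  last = trans (cong +_ (momentTerm-last e (suc m))) (pos-*₃ (suc m) (suc m) _)

central-binomial-step : ∀ m → + suc m * + ((2 ℕ.* suc m) C suc m) ≡ + 2 * + suc (2 ℕ.* m) * + ((2 ℕ.* m) C m)
central-binomial-step m =
  trans (sym (pos-* (suc m) _))
    (trans (cong +_ ([n+1]*[2n+2]C[n+1]≡2*[2n+1]*[2n]Cn m)) (pos-*₃ 2 (suc (2 ℕ.* m)) _))

first-moment : ∀ n → + 2 * moment 1 n ≡ + n * + ((2 ℕ.* n) C n)
first-moment ℕ.zero    = refl
first-moment (suc m) = begin
  + 2 * (Σ₁ m f + f (suc m)) ≡⟨ cong (λ w → + 2 * (Σ₁ m f + w)) last ⟩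
  + 2 * (Σ₁ m f + g m)       ≡⟨ cong (+ 2 *_) (Σ₁-telescope m f g step) ⟩
  + 2 * g 0                  ≡⟨ pos-* 2 (suc m ℕ.* (suc (2 ℕ.* m) C m)) ⟨
  + (2 ℕ.* (suc m ℕ.* (suc (2 ℕ.* m) C m))) ≡⟨ cong +_ ([n+1]*[2n+2]C[n+1]≡2*[n+1]*[2n+1]Cn m) ⟨
  + (suc m ℕ.* ((2 ℕ.* suc m) C suc m))     ≡⟨ pos-* (suc m) _ ⟩
  + suc m * + ((2 ℕ.* suc m) C suc m)       ∎
  where
  f g : ℕ → ℤ
  f k = + momentTerm 1 (suc m) k
  g k = + (suc m ℕ.* (suc (2 ℕ.* m) C (m ℕ.∸ k)))
  step : ∀ {k} → k ℕ.< m → f (suc k) + g (suc k) ≡ g k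
  step {k} k<m = trans (sym (pos-+ (momentTerm 1 (suc m) (suc k)) _)) (cong +_ (momentTerm-first-telescope k<m))
  last : f (suc m) ≡ g m
  last = cong +_ (trans (momentTerm-diagonal 1 (suc m)) (cong (λ i → suc m ℕ.* (suc (2 ℕ.* m) C i)) (sym (n∸n≡0 m))))

third-moment-algebra : ∀ t u {c₀ c₁ μ₀ μ₁ μ₃} →
  (+ 1 + t) * c₁ ≡ + 2 * u * c₀ →
  + 2 * μ₀ ≡ t * c₀ →
  + 2 * μ₁ ≡ (+ 1 + t) * c₁ →
  μ₃ + + 2 * (+ 1 + t) * u * μ₀ ≡ (+ 1 + t) * (+ 1 + t) * μ₁ →
  + 2 * μ₃ ≡ (+ 1 + t) * (+ 1 + t) * c₁
third-moment-algebra t u {c₀} {c₁} {μ₀} {μ₁} {μ₃} central first₀ first₁ recurrence = begin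
  + 2 * μ₃
    ≡⟨ solve (t ∷ u ∷ μ₀ ∷ μ₃ ∷ []) ⟩
  + 2 * (μ₃ + + 2 * (+ 1 + t) * u * μ₀) - + 2 * (+ 1 + t) * u * (+ 2 * μ₀)
    ≡⟨ cong₂ (λ a b → + 2 * a - + 2 * (+ 1 + t) * u * b) recurrence first₀ ⟩
  + 2 * ((+ 1 + t) * (+ 1 + t) * μ₁) - + 2 * (+ 1 + t) * u * (t * c₀)
    ≡⟨ solve (t ∷ u ∷ c₀ ∷ μ₁ ∷ []) ⟩
  (+ 1 + t) * (+ 1 + t) * (+ 2 * μ₁) - t * (+ 1 + t) * (+ 2 * u * c₀)
    ≡⟨ cong₂ (λ a b → (+ 1 + t) * (+ 1 + t) * a - t * (+ 1 + t) * b) first₁ (sym central) ⟩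
  (+ 1 + t) * (+ 1 + t) * ((+ 1 + t) * c₁) - t * (+ 1 + t) * ((+ 1 + t) * c₁)
    ≡⟨ solve (t ∷ c₁ ∷ []) ⟩
  (+ 1 + t) * (+ 1 + t) * c₁
    ∎

third-moment : ∀ n → + 2 * moment 3 n ≡ + n * + n * + ((2 ℕ.* n) C n)
third-moment ℕ.zero    = refl
third-moment (suc m) =
  third-moment-algebra (+ m) (+ suc (2 ℕ.* m))
    (central-binomial-step m) (first-moment m) (first-moment (suc m)) (moment-step 1 m)

gandhi-step-algebra : ∀ s t u σ {c₀ c₁ p₀ p₁ μ₀ μ₁ μ₂} →
  s * c₁ ≡ + 2 * u * c₀ →
  t * t * c₀ * p₀ ≡ σ * + 2 * μ₀ →
  s * s * c₁ * p₁ ≡ σ * + 2 * μ₁ →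
  μ₂ + + 2 * s * u * μ₀ ≡ s * s * μ₁ →
  s * s * c₁ * ((- t) ^ 2 * p₀ - (- s) ^ 2 * p₁) ≡ - + 1 * σ * + 2 * μ₂
gandhi-step-algebra s t u σ {c₀} {c₁} {p₀} {p₁} {μ₀} {μ₁} {μ₂} central at₀ at₁ recurrence = begin
  s * s * c₁ * ((- t) ^ 2 * p₀ - (- s) ^ 2 * p₁)
    ≡⟨⟩
  s * s * c₁ * ((- t) * ((- t) * + 1) * p₀ - (- s) * ((- s) * + 1) * p₁)
    ≡⟨ solve (s ∷ t ∷ c₁ ∷ p₀ ∷ p₁ ∷ []) ⟩
  s * t * t * (s * c₁) * p₀ - s * s * (s * s * c₁ * p₁)
    ≡⟨ cong₂ (λ a b → s * t * t * a * p₀ - s * s * b) central at₁ ⟩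
  s * t * t * (+ 2 * u * c₀) * p₀ - s * s * (σ * + 2 * μ₁)
    ≡⟨ solve (s ∷ t ∷ u ∷ c₀ ∷ p₀ ∷ σ ∷ μ₁ ∷ []) ⟩
  + 2 * s * u * (t * t * c₀ * p₀) - s * s * (σ * + 2 * μ₁)
    ≡⟨ cong (λ a → + 2 * s * u * a - s * s * (σ * + 2 * μ₁)) at₀ ⟩
  + 2 * s * u * (σ * + 2 * μ₀) - s * s * (σ * + 2 * μ₁)
    ≡⟨ solve (s ∷ u ∷ σ ∷ μ₀ ∷ μ₁ ∷ []) ⟩
  - + 1 * σ * + 2 * (s * s * μ₁ - + 2 * s * u * μ₀)
    ≡⟨ cong (λ a → - + 1 * σ * + 2 * (a - + 2 * s * u * μ₀)) recurrence ⟨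
  - + 1 * σ * + 2 * (μ₂ + + 2 * s * u * μ₀ - + 2 * s * u * μ₀)
    ≡⟨ solve (s ∷ u ∷ σ ∷ μ₀ ∷ μ₂ ∷ []) ⟩
  - + 1 * σ * + 2 * μ₂
    ∎

-[1+n]+1≡-n : ∀ n → - + suc n + + 1 ≡ - + n
-[1+n]+1≡-n ℕ.zero    = refl
-[1+n]+1≡-n (suc n) = refl

gandhi-moment : ∀ r n →
  + n * + n * + ((2 ℕ.* n) C n) * P̃ (suc r) (- + n) ≡ (- + 1) ^ r * + 2 * moment (2 ℕ.* suc r ℕ.+ 1) n
gandhi-moment ℕ.zero    n = trans (*-identityʳ _) (sym (third-moment n))
gandhi-moment (suc r) ℕ.zero    = sym (*-zeroʳ ((- + 1) ^ suc r * + 2))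
gandhi-moment (suc r) (suc m) = begin
  s * s * c₁ * ((- s + + 1) ^ 2 * P̃ (suc r) (- s + + 1) - (- s) ^ 2 * P̃ (suc r) (- s))
    ≡⟨ cong (λ z → s * s * c₁ * (z ^ 2 * P̃ (suc r) z - (- s) ^ 2 * P̃ (suc r) (- s))) (-[1+n]+1≡-n m) ⟩
  s * s * c₁ * ((- + m) ^ 2 * P̃ (suc r) (- + m) - (- s) ^ 2 * P̃ (suc r) (- s))
    ≡⟨ gandhi-step-algebra s (+ m) (+ suc (2 ℕ.* m)) ((- + 1) ^ r)
         (central-binomial-step m) (gandhi-moment r m) (gandhi-moment r (suc m)) (moment-step e m) ⟩
  - + 1 * (- + 1) ^ r * + 2 * moment (2 ℕ.+ e) (suc m)
    ≡⟨ cong (λ e′ → - + 1 * (- + 1) ^ r * + 2 * moment e′ (suc m)) (cong (ℕ._+ 1) (ℕ.*-suc 2 (suc r))) ⟨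
  (- + 1) ^ suc r * + 2 * moment (2 ℕ.* suc (suc r) ℕ.+ 1) (suc m)
    ∎
  where
  s c₁ : ℤ
  s = + suc m
  c₁ = + ((2 ℕ.* suc m) C suc m)
  e = 2 ℕ.* suc r ℕ.+ 1

gandhi-at-minus-one : ∀ r → P̃ (suc r) (- + 1) ≡ (- + 1) ^ r
gandhi-at-minus-one r = *-cancelˡ-≡ (+ 2) _ _ (begin
  + 2 * P̃ (suc r) (- + 1)        ≡⟨ gandhi-moment r 1 ⟩
  (- + 1) ^ r * + 2 * moment e 1 ≡⟨ cong (λ w → (- + 1) ^ r * + 2 * + w) (trans (momentTerm-diagonal e 1) (^-zeroˡ e)) ⟩
  (- + 1) ^ r * + 2 * + 1        ≡⟨ *-identityʳ ((- + 1) ^ r * + 2) ⟩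
  (- + 1) ^ r * + 2              ≡⟨ *-comm ((- + 1) ^ r) (+ 2) ⟩
  + 2 * (- + 1) ^ r              ∎)
  where e = 2 ℕ.* suc r ℕ.+ 1

moment-at-two : ∀ r → moment (2 ℕ.* suc r ℕ.+ 1) 2 ≡ + 4 * + (2 ℕ.^ (2 ℕ.* suc r ℕ.∸ 1) ℕ.+ 1)
moment-at-two r = trans
  (cong +_ (evaluate {y = 2 ℕ.^ x} (^-zeroˡ (2 ℕ.* suc r ℕ.+ 1)) (cong (λ i → 2 ℕ.^ suc i) (ℕ.+-comm x 1))))
  (pos-* 4 (2 ℕ.^ x ℕ.+ 1))
  where
  x = 2 ℕ.* suc r ℕ.∸ 1
  evaluate : ∀ {a b y} → a ≡ 1 → b ≡ 2 ℕ.* (2 ℕ.* y) → 4 ℕ.* a ℕ.+ 1 ℕ.* b ≡ 4 ℕ.* (y ℕ.+ 1)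
  evaluate {y = y} refl refl = ℕ-solve (y ∷ [])

gandhi-at-minus-two : ∀ r → + 3 * P̃ (suc r) (- + 2) ≡ (- + 1) ^ r * + (2 ℕ.^ (2 ℕ.* suc r ℕ.∸ 1) ℕ.+ 1)
gandhi-at-minus-two r = *-cancelˡ-≡ (+ 8) _ _ (begin
  + 8 * (+ 3 * P̃ (suc r) (- + 2))        ≡⟨ *-assoc (+ 8) (+ 3) _ ⟨
  + 24 * P̃ (suc r) (- + 2)               ≡⟨ gandhi-moment r 2 ⟩
  σ * + 2 * moment (2 ℕ.* suc r ℕ.+ 1) 2 ≡⟨ cong (λ w → σ * + 2 * w) (moment-at-two r) ⟩
  σ * + 2 * (+ 4 * w)                    ≡⟨ regroup σ w ⟩
  + 8 * (σ * w)                          ∎)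
  where
  σ w : ℤ
  σ = (- + 1) ^ r
  w = + (2 ℕ.^ (2 ℕ.* suc r ℕ.∸ 1) ℕ.+ 1)
  regroup : ∀ a b → a * + 2 * (+ 4 * b) ≡ + 8 * (a * b)
  regroup a b = solve (a ∷ b ∷ [])

pos-square : ∀ n → + (n ℕ.^ 2) ≡ + n * + n
pos-square n = trans (cong (λ i → + (n ℕ.* i)) (ℕ.*-identityʳ n)) (pos-* n n)

mainTheorem5 : (r : ℕ) → 1 ≤ r →
    ((n : ℕ) → 1 ≤ n →
      (+ (n ℕ.^ 2)) * (+ ((2 ℕ.* n) C n)) * P̃ r (- (+ n))
        ≡ ((- + 1) ^ (r ℕ.∸ 1)) * + 2
          * Σ₁ n (λ k → + (((2 ℕ.* n) C (n ℕ.∸ k)) ℕ.* (k ℕ.^ (2 ℕ.* r ℕ.+ 1)))))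
    × (P̃ r (- + 1) ≡ (- + 1) ^ (r ℕ.∸ 1))
    × (+ 3 * P̃ r (- + 2) ≡ ((- + 1) ^ (r ℕ.∸ 1)) * + (2 ℕ.^ (2 ℕ.* r ℕ.∸ 1) ℕ.+ 1))
mainTheorem5 ℕ.zero ()
mainTheorem5 (suc r) _ =
    (λ n _ → trans (cong (λ a → a * + ((2 ℕ.* n) C n) * P̃ (suc r) (- + n)) (pos-square n)) (gandhi-moment r n))
  , gandhi-at-minus-one r
  , gandhi-at-minus-two r
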